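{- Let $G$ be a graph and $u\ne v$ two vertices of $G$ with $d_G(u)\ge d_G(v)>1$. Let $s\ge 1$, $t\ge 0$, and let $G_1$ be obtained from $G$ by identifying $u$ with the end vertex $u_0$ of a new path $u_0u_1\cdots u_s$ and identifying $v$ with the end vertex $v_0$ of a new path $v_0v_1\cdots v_t$ (the two paths vertex-disjoint from each other and from $G$ except at $u_0=u$, $v_0=v$; for $t=0$ the second path is just $v$). Let $G_2=G_1-uu_1+v_tu_1$. Then (i) if $t>0$, $F(G_1)>F(G_2)$; (ii) if $t=0$ and $d_G(u)>d_G(v)$, $F(G_1)>F(G_2)$.
   Context: All graphs are finite and simple. The F-index is $F(G)=\sum_{v\in V(G)} d_G(v)^3$, with $d_G(v)$ the degree of $v$ in $G$. $G-e$ denotes deletion of edge $e$ and $G+e$ addition of a new edge $e$. -}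

module Defs where

open import Data.Nat using (ℕ; zero; suc; _^_; _≡ᵇ_)
open import Data.Fin using (Fin; toℕ; splitAt)
open import Data.Fin.Properties using (_≟_)
open import Data.Bool using (Bool; true; false; if_then_else_; _∧_; _∨_; not)
open import Data.List using (List; map; allFin)
open import Data.Nat.ListAction using (sum)
open import Data.Sum using (_⊎_; inj₁; inj₂)
open import Relation.Nullary.Decidable using (⌊_⌋)
open import Relation.Binary.PropositionalEquality using (_≡_)

Adj : ℕ → Set
Adj n = Fin n → Fin n → Bool

IsSimple : ∀ {n} → Adj n → Set
IsSimple {n} A = (∀ i j → A i j ≡ A j i) × (∀ i → A i i ≡ false)
  where open import Data.Product using (_×_)

deg : ∀ {n} → Adj n → Fin n → ℕ
deg {n} A i = sum (map (λ j → if A i j then 1 else 0) (allFin n))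

Findex : ∀ {n} → Adj n → ℕ
Findex {n} A = sum (map (λ i → deg A i ^ 3) (allFin n))

-- Vertices of G₁: original vertices (Fin n), new path vertices
-- u₁..u_s (inj₂ (inj₁ k) is u_{k+1}), new path vertices v₁..v_t
-- (inj₂ (inj₂ k) is v_{k+1}).
V : ℕ → ℕ → ℕ → Set
V n s t = Fin n ⊎ (Fin s ⊎ Fin t)

decode : ∀ {n s t} → Fin (n Data.Nat.+ (s Data.Nat.+ t)) → V n s t
decode {n} {s} {t} x with splitAt n x
... | inj₁ a = inj₁ a
... | inj₂ y with splitAt s y
...   | inj₁ b = inj₂ (inj₁ b)
...   | inj₂ c = inj₂ (inj₂ c)

base₁ : ∀ {n s t} → Adj n → Fin n → Fin n → V n s t → V n s t → Bool
base₁ A u v (inj₁ a) (inj₁ b) = A a b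
base₁ A u v (inj₁ a) (inj₂ (inj₁ k)) = ⌊ a ≟ u ⌋ ∧ (toℕ k ≡ᵇ 0)
base₁ A u v (inj₂ (inj₁ k)) (inj₂ (inj₁ k')) = suc (toℕ k) ≡ᵇ toℕ k'
base₁ A u v (inj₁ a) (inj₂ (inj₂ k)) = ⌊ a ≟ v ⌋ ∧ (toℕ k ≡ᵇ 0)
base₁ A u v (inj₂ (inj₂ k)) (inj₂ (inj₂ k')) = suc (toℕ k) ≡ᵇ toℕ k'
base₁ A u v _ _ = false

adj₁V : ∀ {n s t} → Adj n → Fin n → Fin n → V n s t → V n s t → Bool
adj₁V A u v x y = base₁ A u v x y ∨ base₁ A u v y x

isU : ∀ {n s t} → Fin n → V n s t → Bool
isU u (inj₁ a) = ⌊ a ≟ u ⌋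
isU u _ = false

isU₁ : ∀ {n s t} → V n s t → Bool
isU₁ (inj₂ (inj₁ k)) = toℕ k ≡ᵇ 0
isU₁ _ = false

-- is x the vertex v_t ? (v_t = v when t = 0)
isVt : ∀ {n s t} → Fin n → V n s t → Bool
isVt {t = t} v (inj₁ a) = (t ≡ᵇ 0) ∧ ⌊ a ≟ v ⌋
isVt {t = t} v (inj₂ (inj₂ k)) = suc (toℕ k) ≡ᵇ t
isVt v _ = false

adj₂V : ∀ {n s t} → Adj n → Fin n → Fin n → V n s t → V n s t → Bool
adj₂V A u v x y =
  (adj₁V A u v x y ∧ not ((isU u x ∧ isU₁ y) ∨ (isU u y ∧ isU₁ x)))
  ∨ ((isVt v x ∧ isU₁ y) ∨ (isVt v y ∧ isU₁ x))

G₁ : ∀ {n} → Adj n → Fin n → Fin n → (s t : ℕ) → Adj (n Data.Nat.+ (s Data.Nat.+ t))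
G₁ A u v s t x y = adj₁V {t = t} A u v (decode {s = s} x) (decode {s = s} y)

G₂ : ∀ {n} → Adj n → Fin n → Fin n → (s t : ℕ) → Adj (n Data.Nat.+ (s Data.Nat.+ t))
G₂ A u v s t x y = adj₂V {t = t} A u v (decode {s = s} x) (decode {s = s} y)

-- G₂ arises from G₁ by moving the end u of the edge uu₁ to v_t.  So the degree a of u drops by
-- one, the degree b of v_t rises by one, and every other degree (u₁'s included) is unchanged:
-- F(G₁) − F(G₂) = a³ + b³ − (a − 1)³ − (b + 1)³, which is positive exactly when b < a − 1.
-- Here a ≥ d_G(u) + 1, while b ≤ 1 when t > 0 (v_t ends a path) and b = d_G(v) when t = 0,
-- and the hypotheses on d_G(u), d_G(v) give b < a − 1 in either case.
module Submission where

open import Defs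
open import Data.Nat using (ℕ; zero; suc; _+_; _*_; _^_; _≤_; _<_; _≥_; _>_; _≡ᵇ_; z≤n; s≤s)
open import Data.Nat.Properties
  using (module ≤-Reasoning; ≤-refl; ≤-trans; ≤-reflexive; ≤-pred; <⇒≢; m<m+n; m≤m+n;
         m≤n⇒∃[o]m+o≡n; +-0-commutativeMonoid; +-comm; +-assoc; +-identityʳ; +-cancelʳ-≡;
         +-cancelʳ-<; +-monoʳ-<; suc-injective; ≡ᵇ⇒≡; ≡⇒≡ᵇ)
open import Data.Nat.Tactic.RingSolver using (solve-∀)
open import Data.Fin using (Fin; zero; suc; punchIn; _↑ˡ_; _↑ʳ_; splitAt; join; toℕ; fromℕ; inject₁)
open import Data.Sum using (inj₁; inj₂)
open import Data.Fin.Properties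
  using (_≟_; punchInᵢ≢i; splitAt-↑ˡ; splitAt-↑ʳ; join-splitAt; toℕ-fromℕ; toℕ-injective;
         toℕ-inject₁; toℕ<n)
open import Relation.Nullary using (yes; no)
open import Relation.Nullary.Decidable using (⌊_⌋; isYes≗does; dec-true; dec-false; toWitness)
open import Function.Bundles using (Equivalence)
open import Data.Bool using (Bool; true; false; if_then_else_; _∧_; _∨_; not)
open import Data.Bool.Properties using (∧-zeroʳ; ∨-zeroʳ; ∨-idem; ∨-comm; T-≡; T-∨)
open import Data.List using (map; tabulate)
import Data.Nat.ListAction as ListAction
open import Data.Vec.Functional using (removeAt; updateAt)
open import Data.Vec.Functional.Properties using (updateAt-updates; updateAt-minimal)
open import Data.Product using (_×_; _,_)
open import Data.Empty using (⊥-elim)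
open import Function using (_∘_)
open import Relation.Binary.PropositionalEquality
  using (_≡_; _≢_; refl; sym; trans; cong; cong₂; subst; module ≡-Reasoning)
open import Algebra.Properties.CommutativeMonoid.Sum +-0-commutativeMonoid
  using (sum; sum-syntax; sum-cong-≗; sum-remove; sum-replicate-zero)

∑-map-tabulate : ∀ {A : Set} {N} (h : A → ℕ) (f : Fin N → A) →
  ListAction.sum (map h (tabulate f)) ≡ ∑[ i < N ] h (f i)
∑-map-tabulate {N = zero}  h f = refl
∑-map-tabulate {N = suc N} h f = cong (h (f zero) +_) (∑-map-tabulate h (f ∘ suc))

∑-++ : ∀ m n (f : Fin (m + n) → ℕ) →
  ∑[ i < m + n ] f i ≡ ∑[ i < m ] f (i ↑ˡ n) + ∑[ j < n ] f (m ↑ʳ j)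
∑-++ zero    n f = refl
∑-++ (suc m) n f = trans (cong (f zero +_) (∑-++ m n (f ∘ suc))) (sym (+-assoc (f zero) _ _))

∑-exchange : ∀ {N} (f g : Fin N → ℕ) (p : Fin N) → (∀ x → x ≢ p → f x ≡ g x) →
  ∑[ x < N ] f x + g p ≡ ∑[ x < N ] g x + f p
∑-exchange {suc N} f g p agree = begin
  sum f + g p                     ≡⟨ cong (_+ g p) (sum-remove f) ⟩
  f p + sum (removeAt f p) + g p  ≡⟨ cong (λ z → f p + z + g p) (sum-cong-≗ agree-removed) ⟩
  f p + sum (removeAt g p) + g p  ≡⟨ swap (f p) (sum (removeAt g p)) (g p) ⟩
  g p + sum (removeAt g p) + f p  ≡⟨ cong (_+ f p) (sum-remove g) ⟨
  sum g + f p                     ∎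
  where
  open ≡-Reasoning
  agree-removed : ∀ j → removeAt f p j ≡ removeAt g p j
  agree-removed j = agree (punchIn p j) (punchInᵢ≢i p j)
  swap : ∀ a r b → a + r + b ≡ b + r + a
  swap = solve-∀

∑-exchange₂ : ∀ {N} (f g : Fin N → ℕ) {p r : Fin N} → p ≢ r →
  (∀ x → x ≢ p → x ≢ r → f x ≡ g x) →
  ∑[ x < N ] f x + (g p + g r) ≡ ∑[ x < N ] g x + (f p + f r)
∑-exchange₂ f g {p} {r} p≢r agree = begin
  sum f + (g p + g r)  ≡⟨ +-assoc (sum f) _ _ ⟨
  sum f + g p + g r    ≡⟨ cong (λ z → sum f + z + g r) (updateAt-updates p f) ⟨
  sum f + h p + g r    ≡⟨ cong (_+ g r) (∑-exchange f h p f≈h) ⟩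
  sum h + f p + g r    ≡⟨ swap (sum h) (f p) (g r) ⟩
  sum h + g r + f p    ≡⟨ cong (_+ f p) (∑-exchange h g r h≈g) ⟩
  sum g + h r + f p    ≡⟨ cong (λ z → sum g + z + f p) (updateAt-minimal r p f (p≢r ∘ sym)) ⟩
  sum g + f r + f p    ≡⟨ +-assoc (sum g) _ _ ⟩
  sum g + (f r + f p)  ≡⟨ cong (sum g +_) (+-comm (f r) (f p)) ⟩
  sum g + (f p + f r)  ∎
  where
  open ≡-Reasoning
  h : Fin _ → ℕ
  h = updateAt f p (λ _ → g p)
  f≈h : ∀ x → x ≢ p → f x ≡ h x
  f≈h x x≢p = sym (updateAt-minimal x p f x≢p)
  h≈g : ∀ x → x ≢ r → h x ≡ g x
  h≈g x x≢r with x ≟ p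
  ... | yes refl = updateAt-updates p f
  ... | no x≢p = trans (updateAt-minimal x p f x≢p) (agree x x≢p x≢r)
  swap : ∀ a b c → a + b + c ≡ a + c + b
  swap = solve-∀

cube-transfer-< : ∀ {a b} → b < a → a ^ 3 + suc b ^ 3 < suc a ^ 3 + b ^ 3
cube-transfer-< {a} {b} b<a with m≤n⇒∃[o]m+o≡n b<a
... | k , refl = subst (suc (b + k) ^ 3 + suc b ^ 3 <_) (sym (expand b k)) (m<m+n _ (s≤s z≤n))
  where
  -- cubes are spelled out as products, which the ring solver accepts and _^_ unfolds to
  expand : ∀ x y → (2 + x + y) * ((2 + x + y) * ((2 + x + y) * 1)) + x * (x * (x * 1))
                 ≡ (1 + x + y) * ((1 + x + y) * ((1 + x + y) * 1)) + (1 + x) * ((1 + x) * ((1 + x) * 1))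
                   + suc (5 + 3 * y * (y + 2 * x + 3) + 6 * x)
  expand = solve-∀

∑-cube-transfer-< : ∀ {N} (d₁ d₂ : Fin N → ℕ) {p r : Fin N} → p ≢ r →
  (∀ x → x ≢ p → x ≢ r → d₁ x ≡ d₂ x) → d₁ p ≡ suc (d₂ p) → d₂ r ≡ suc (d₁ r) → d₁ r < d₂ p →
  ∑[ x < N ] (d₂ x ^ 3) < ∑[ x < N ] (d₁ x ^ 3)
∑-cube-transfer-< {N} d₁ d₂ {p} {r} p≢r agree d₁p d₂r d₁r<d₂p =
  +-cancelʳ-< _ (sum g) (sum f) (subst (sum g + (g p + g r) <_) (sym exchanged) (+-monoʳ-< (sum g) gain))
  where
  f g : Fin N → ℕ
  f x = d₁ x ^ 3
  g x = d₂ x ^ 3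
  exchanged : sum f + (g p + g r) ≡ sum g + (f p + f r)
  exchanged = ∑-exchange₂ f g p≢r (λ x x≢p x≢r → cong (_^ 3) (agree x x≢p x≢r))
  gain : g p + g r < f p + f r
  gain rewrite d₁p | d₂r = cube-transfer-< d₁r<d₂p

ind : Bool → ℕ
ind b = if b then 1 else 0

deg≡∑ : ∀ {N} (A : Adj N) x → deg A x ≡ ∑[ y < N ] ind (A x y)
deg≡∑ A x = ∑-map-tabulate (λ y → ind (A x y)) (λ y → y)

Findex≡∑ : ∀ {N} (A : Adj N) → Findex A ≡ ∑[ x < N ] (deg A x ^ 3)
Findex≡∑ A = ∑-map-tabulate (λ x → deg A x ^ 3) (λ x → x)

deg-exchange : ∀ {N} (A B : Adj N) x q → (∀ y → y ≢ q → A x y ≡ B x y) →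
  deg A x + ind (B x q) ≡ deg B x + ind (A x q)
deg-exchange A B x q agree rewrite deg≡∑ A x | deg≡∑ B x =
  ∑-exchange _ _ q (λ y y≢q → cong ind (agree y y≢q))

deg-exchange₂ : ∀ {N} (A B : Adj N) x {p r} → p ≢ r →
  (∀ y → y ≢ p → y ≢ r → A x y ≡ B x y) →
  deg A x + (ind (B x p) + ind (B x r)) ≡ deg B x + (ind (A x p) + ind (A x r))
deg-exchange₂ A B x p≢r agree rewrite deg≡∑ A x | deg≡∑ B x =
  ∑-exchange₂ _ _ p≢r (λ y y≢p y≢r → cong ind (agree y y≢p y≢r))

unique-neighbour⇒deg≤1 : ∀ {N} (A : Adj N) x z → (∀ y → A x y ≡ true → y ≡ z) → deg A x ≤ 1
unique-neighbour⇒deg≤1 {N} A x z only = begin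
  deg A x                               ≡⟨ deg≡∑ A x ⟩
  ∑[ y < N ] ind (A x y)                ≡⟨ +-identityʳ _ ⟨
  ∑[ y < N ] ind (A x y) + 0            ≡⟨ ∑-exchange _ (λ _ → 0) z non-neighbour ⟩
  ∑[ y < N ] 0 + ind (A x z)            ≡⟨ cong (_+ ind (A x z)) (sum-replicate-zero N) ⟩
  ind (A x z)                           ≤⟨ ind≤1 (A x z) ⟩
  1                                     ∎
  where
  open ≤-Reasoning
  non-neighbour : ∀ y → y ≢ z → ind (A x y) ≡ 0
  non-neighbour y y≢z with A x y in eq
  ... | true  = ⊥-elim (y≢z (only y eq))
  ... | false = refl
  ind≤1 : ∀ b → ind b ≤ 1
  ind≤1 true  = ≤-refl
  ind≤1 false = z≤n

record IsIndicator {N} (P : Fin N → Bool) (p : Fin N) : Set where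
  field
    true-at   : P p ≡ true
    false-off : ∀ {x} → x ≢ p → P x ≡ false

-- A − pq + rq, the vertices p, q, r being given by indicator predicates; G₂ G u v s t is
-- definitionally moveEdge (G₁ G u v s t) (isU u ∘ decode) (isU₁ ∘ decode) (isVt v ∘ decode).
moveEdge : ∀ {N} → Adj N → (P Q R : Fin N → Bool) → Adj N
moveEdge A P Q R x y = (A x y ∧ not ((P x ∧ Q y) ∨ (P y ∧ Q x))) ∨ ((R x ∧ Q y) ∨ (R y ∧ Q x))

module MoveEdge {N} (A : Adj N) (A-sym : ∀ x y → A x y ≡ A y x)
  {P Q R : Fin N → Bool} {p q r : Fin N}
  (P-ind : IsIndicator P p) (Q-ind : IsIndicator Q q) (R-ind : IsIndicator R r)
  (p≢q : p ≢ q) (q≢r : q ≢ r) (p≢r : p ≢ r)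
  (A-pq : A p q ≡ true) (A-rq : A r q ≡ false) where

  private
    B : Adj N
    B = moveEdge A P Q R
    module P = IsIndicator P-ind
    module Q = IsIndicator Q-ind
    module R = IsIndicator R-ind

    unchanged : ∀ a → (a ∧ not (false ∨ false)) ∨ (false ∨ false) ≡ a
    unchanged true  = refl
    unchanged false = refl

    B-off-q : ∀ {x y} → x ≢ q → y ≢ q → B x y ≡ A x y
    B-off-q {x} {y} x≢q y≢q rewrite Q.false-off x≢q | Q.false-off y≢q
      | ∧-zeroʳ (P x) | ∧-zeroʳ (P y) | ∧-zeroʳ (R x) | ∧-zeroʳ (R y) = unchanged (A x y)

    P-q : P q ≡ false
    P-q = P.false-off (p≢q ∘ sym)
    R-q : R q ≡ false
    R-q = R.false-off q≢r

    B-column-q : ∀ {x} → x ≢ p → x ≢ r → B x q ≡ A x q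
    B-column-q {x} x≢p x≢r rewrite P.false-off x≢p | R.false-off x≢r | P-q | R-q = unchanged (A x q)

    B-row-q : ∀ {y} → y ≢ p → y ≢ r → B q y ≡ A q y
    B-row-q {y} y≢p y≢r rewrite P.false-off y≢p | R.false-off y≢r | P-q | R-q = unchanged (A q y)

    B-pq : B p q ≡ false
    B-pq rewrite P.true-at | Q.true-at | R.false-off p≢r | R-q | ∧-zeroʳ (A p q) = refl

    B-qp : B q p ≡ false
    B-qp rewrite P.true-at | Q.true-at | P-q | R-q | R.false-off p≢r | ∧-zeroʳ (A q p) = refl

    B-rq : B r q ≡ true
    B-rq rewrite R.true-at | Q.true-at = ∨-zeroʳ _

    B-qr : B q r ≡ true
    B-qr rewrite R.true-at | Q.true-at | R-q = ∨-zeroʳ _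

  deg-p : deg A p ≡ suc (deg B p)
  deg-p with deg-exchange A B p q (λ _ y≢q → sym (B-off-q p≢q y≢q))
  ... | e rewrite B-pq | A-pq | +-identityʳ (deg A p) | +-comm (deg B p) 1 = e

  deg-r : deg B r ≡ suc (deg A r)
  deg-r with deg-exchange A B r q (λ _ y≢q → sym (B-off-q (q≢r ∘ sym) y≢q))
  ... | e rewrite B-rq | A-rq | +-identityʳ (deg B r) | +-comm (deg A r) 1 = sym e

  deg-q : deg B q ≡ deg A q
  deg-q with deg-exchange₂ A B q p≢r (λ _ y≢p y≢r → sym (B-row-q y≢p y≢r))
  ... | e rewrite B-qp | B-qr | A-sym q p | A-sym q r | A-pq | A-rq = sym (+-cancelʳ-≡ 1 _ _ e)

  deg-off-pr : ∀ {x} → x ≢ p → x ≢ r → deg B x ≡ deg A x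
  deg-off-pr {x} x≢p x≢r with x ≟ q
  ... | yes refl = deg-q
  ... | no x≢q = trans (deg≡∑ B x) (trans (sum-cong-≗ (cong ind ∘ B-row-x)) (sym (deg≡∑ A x)))
    where
    B-row-x : ∀ y → B x y ≡ A x y
    B-row-x y with y ≟ q
    ... | yes refl = B-column-q x≢p x≢r
    ... | no y≢q = B-off-q x≢q y≢q

  Findex-moveEdge-< : suc (deg A r) < deg A p → Findex B < Findex A
  Findex-moveEdge-< lt rewrite Findex≡∑ A | Findex≡∑ B =
    ∑-cube-transfer-< (deg A) (deg B) p≢r (λ _ x≢p x≢r → sym (deg-off-pr x≢p x≢r))
      deg-p deg-r (≤-pred (subst (suc (deg A r) <_) deg-p lt))

join-of-splitAt : ∀ {m k} {z : Fin (m + k)} {w} → splitAt m z ≡ w → join m k w ≡ z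
join-of-splitAt {m} {k} {z} refl = join-splitAt m k z

module Encoding {n s t : ℕ} where

  encode : V n s t → Fin (n + (s + t))
  encode (inj₁ a)        = a ↑ˡ (s + t)
  encode (inj₂ (inj₁ b)) = n ↑ʳ (b ↑ˡ t)
  encode (inj₂ (inj₂ c)) = n ↑ʳ (s ↑ʳ c)

  decode-encode : ∀ w → decode (encode w) ≡ w
  decode-encode (inj₁ a) rewrite splitAt-↑ˡ n a (s + t) = refl
  decode-encode (inj₂ (inj₁ b)) rewrite splitAt-↑ʳ n (s + t) (b ↑ˡ t) | splitAt-↑ˡ s b t = refl
  decode-encode (inj₂ (inj₂ c)) rewrite splitAt-↑ʳ n (s + t) (s ↑ʳ c) | splitAt-↑ʳ s t c = refl

  encode-decode : ∀ x → encode (decode {n} {s} {t} x) ≡ x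
  encode-decode x with splitAt n x in eq₁
  ... | inj₁ a = join-of-splitAt eq₁
  ... | inj₂ y with splitAt s y in eq₂
  ...   | inj₁ b = trans (cong (n ↑ʳ_) (join-of-splitAt eq₂)) (join-of-splitAt eq₁)
  ...   | inj₂ c = trans (cong (n ↑ʳ_) (join-of-splitAt eq₂)) (join-of-splitAt eq₁)

  encode-injective : ∀ {w w′} → encode w ≡ encode w′ → w ≡ w′
  encode-injective {w} {w′} e = trans (sym (decode-encode w)) (trans (cong decode e) (decode-encode w′))

  decode-indicator : (S : V n s t → Bool) (w : V n s t) →
    S w ≡ true → (∀ w′ → S w′ ≡ true → w′ ≡ w) → IsIndicator (S ∘ decode) (encode w)
  decode-indicator S w S-w S-only = record { true-at = true-at ; false-off = false-off }
    where
    true-at : S (decode (encode w)) ≡ true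
    true-at = trans (cong S (decode-encode w)) S-w
    false-off : ∀ {x} → x ≢ encode w → S (decode x) ≡ false
    false-off {x} x≢w with S (decode x) in eq
    ... | true  = ⊥-elim (x≢w (trans (sym (encode-decode x)) (cong encode (S-only (decode x) eq))))
    ... | false = refl

  ∑-decode : (h : V n s t → ℕ) → ∑[ x < n + (s + t) ] h (decode x)
    ≡ ∑[ a < n ] h (inj₁ a) + (∑[ b < s ] h (inj₂ (inj₁ b)) + ∑[ c < t ] h (inj₂ (inj₂ c)))
  ∑-decode h = trans (∑-++ n (s + t) _) (cong₂ _+_ (sum-cong-≗ (on-decoded ∘ inj₁))
    (trans (∑-++ s t _) (cong₂ _+_ (sum-cong-≗ (on-decoded ∘ inj₂ ∘ inj₁))
                                   (sum-cong-≗ (on-decoded ∘ inj₂ ∘ inj₂)))))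
    where
    on-decoded : ∀ w → h (decode (encode w)) ≡ h w
    on-decoded w = cong h (decode-encode w)

⌊≟⌋-refl : ∀ {m} (a : Fin m) → ⌊ a ≟ a ⌋ ≡ true
⌊≟⌋-refl a = trans (isYes≗does (a ≟ a)) (dec-true (a ≟ a) refl)

⌊≟⌋-≢ : ∀ {m} {a b : Fin m} → a ≢ b → ⌊ a ≟ b ⌋ ≡ false
⌊≟⌋-≢ {a = a} {b} a≢b = trans (isYes≗does (a ≟ b)) (dec-false (a ≟ b) a≢b)

⌊≟⌋-true : ∀ {m} {a b : Fin m} → ⌊ a ≟ b ⌋ ≡ true → a ≡ b
⌊≟⌋-true e = toWitness (Equivalence.from T-≡ e)

≡ᵇ-true : ∀ {m k} → (m ≡ᵇ k) ≡ true → m ≡ k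
≡ᵇ-true {m} {k} e = ≡ᵇ⇒≡ m k (Equivalence.from T-≡ e)

pathEnd : ∀ {n s} → Fin n → (t : ℕ) → V n s t
pathEnd v zero    = inj₁ v
pathEnd v (suc t) = inj₂ (inj₂ (fromℕ t))

pathPenultimate : ∀ {n s} → Fin n → (t : ℕ) → V n s (suc t)
pathPenultimate v zero    = inj₁ v
pathPenultimate v (suc t) = inj₂ (inj₂ (inject₁ (fromℕ t)))

isU-only : ∀ {n s t} {u : Fin n} (w : V n s t) → isU u w ≡ true → w ≡ inj₁ u
isU-only (inj₁ a) e = cong inj₁ (⌊≟⌋-true e)

isU₁-only : ∀ {n s t} (w : V n (suc s) t) → isU₁ w ≡ true → w ≡ inj₂ (inj₁ zero)
isU₁-only (inj₂ (inj₁ zero)) _ = refl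

isVt-end : ∀ {n s} (v : Fin n) t → isVt {s = s} v (pathEnd v t) ≡ true
isVt-end v zero    = ⌊≟⌋-refl v
isVt-end v (suc t) rewrite toℕ-fromℕ t = Equivalence.to T-≡ (≡⇒≡ᵇ t t refl)

isVt-only : ∀ {n s} {v : Fin n} t (w : V n s t) → isVt v w ≡ true → w ≡ pathEnd v t
isVt-only zero    (inj₁ a)        e = cong inj₁ (⌊≟⌋-true e)
isVt-only zero    (inj₂ (inj₂ ()))
isVt-only (suc t) (inj₂ (inj₂ c)) e =
  cong (inj₂ ∘ inj₂) (toℕ-injective (trans (≡ᵇ-true e) (sym (toℕ-fromℕ t))))

path-successor : ∀ {k m} → m < suc k → ((suc k ≡ᵇ m) ∨ (suc m ≡ᵇ k)) ≡ true → suc m ≡ k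
path-successor {k} {m} m<k+1 e with Equivalence.to T-∨ (Equivalence.from T-≡ e)
... | inj₁ k+1≡m = ⊥-elim (<⇒≢ m<k+1 (sym (≡ᵇ⇒≡ (suc k) m k+1≡m)))
... | inj₂ m+1≡k = ≡ᵇ⇒≡ (suc m) k m+1≡k

module PathGraph {n} (G : Adj n) (G-sym : ∀ i j → G i j ≡ G j i)
  {u v : Fin n} (u≢v : u ≢ v) (s′ : ℕ) where

  s : ℕ
  s = suc s′

  adj : ∀ {t} → V n s t → V n s t → Bool
  adj {t} = adj₁V {s = s} {t = t} G u v

  u₁ : ∀ {t} → V n s t
  u₁ = inj₂ (inj₁ zero)

  adj-sym : ∀ {t} (w w′ : V n s t) → adj w w′ ≡ adj w′ w
  adj-sym {t} w w′ = ∨-comm (base₁ {s = s} {t = t} G u v w w′) (base₁ G u v w′ w)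

  adj-inj₁ : ∀ {t} a b → adj {t} (inj₁ a) (inj₁ b) ≡ G a b
  adj-inj₁ a b rewrite G-sym b a = ∨-idem (G a b)

  adj-u-u₁ : ∀ {t} → adj {t} (inj₁ u) u₁ ≡ true
  adj-u-u₁ rewrite ⌊≟⌋-refl u = refl

  adj-end-u₁ : ∀ t → adj (pathEnd v t) u₁ ≡ false
  adj-end-u₁ zero    rewrite ⌊≟⌋-≢ (u≢v ∘ sym) = refl
  adj-end-u₁ (suc t) = refl

  end-neighbour : ∀ t w → adj (pathEnd v (suc t)) w ≡ true → w ≡ pathPenultimate v t
  end-neighbour zero (inj₁ a) e with a ≟ v
  ... | yes refl = refl
  end-neighbour zero    (inj₁ a) () | no _
  end-neighbour (suc t) (inj₁ a) e with a ≟ v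
  end-neighbour (suc t) (inj₁ a) () | yes _
  end-neighbour (suc t) (inj₁ a) () | no _
  end-neighbour t (inj₂ (inj₂ c)) e = penultimate t c (path-successor (toℕ<n c)
    (subst (λ k → ((suc k ≡ᵇ toℕ c) ∨ (suc (toℕ c) ≡ᵇ k)) ≡ true) (toℕ-fromℕ t) e))
    where
    penultimate : ∀ t (c : Fin (suc t)) → suc (toℕ c) ≡ t →
      inj₂ (inj₂ c) ≡ pathPenultimate {s = s} v t
    penultimate (suc t) c e = cong (inj₂ ∘ inj₂)
      (toℕ-injective (trans (suc-injective e) (sym (trans (toℕ-inject₁ _) (toℕ-fromℕ t)))))

  open module Encodingₜ {t} = Encoding {n} {s} {t}

  module _ (t : ℕ) where

    G₁′ : Adj (n + (s + t))
    G₁′ = G₁ G u v s t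

    G₁′-encode : ∀ w x → G₁′ (encode w) x ≡ adj w (decode x)
    G₁′-encode w x = cong (λ w′ → adj w′ (decode x)) (decode-encode w)

    deg-G₁′ : ∀ w → deg G₁′ (encode w) ≡ ∑[ a < n ] ind (adj w (inj₁ a))
      + (∑[ b < s ] ind (adj w (inj₂ (inj₁ b))) + ∑[ c < t ] ind (adj w (inj₂ (inj₂ c))))
    deg-G₁′ w = trans (deg≡∑ G₁′ (encode w))
      (trans (sum-cong-≗ (cong ind ∘ G₁′-encode w)) (∑-decode (ind ∘ adj w)))

    ∑-adj-inj₁ : ∀ a → ∑[ b < n ] ind (adj {t} (inj₁ a) (inj₁ b)) ≡ deg G a
    ∑-adj-inj₁ a = trans (sum-cong-≗ (cong ind ∘ adj-inj₁ {t} a)) (sym (deg≡∑ G a))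

    deg-u-lower : suc (deg G u) ≤ deg G₁′ (encode (inj₁ u))
    deg-u-lower rewrite deg-G₁′ (inj₁ u) | sym (∑-adj-inj₁ u) =
      m<m+n _ (≤-trans (≤-reflexive (cong ind (sym (adj-u-u₁ {t}))))
                       (≤-trans (m≤m+n _ _) (m≤m+n _ _)))

  deg-v : deg (G₁′ 0) (encode {t = 0} (inj₁ v)) ≡ deg G v
  deg-v rewrite deg-G₁′ 0 (inj₁ v) | ⌊≟⌋-≢ (u≢v ∘ sym) =
    trans (cong₂ _+_ (∑-adj-inj₁ 0 v) (trans (+-identityʳ _) (sum-replicate-zero s))) (+-identityʳ _)

  deg-end≤1 : ∀ t → deg (G₁′ (suc t)) (encode {t = suc t} (pathEnd v (suc t))) ≤ 1
  deg-end≤1 t = unique-neighbour⇒deg≤1 (G₁′ (suc t)) _ (encode (pathPenultimate v t)) only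
    where
    only : ∀ y → G₁′ (suc t) (encode (pathEnd v (suc t))) y ≡ true →
      y ≡ encode (pathPenultimate v t)
    only y e = trans (sym (encode-decode y))
      (cong encode (end-neighbour t (decode y) (trans (sym (G₁′-encode (suc t) _ y)) e)))

  u≢u₁ : ∀ {t} → inj₁ u ≢ u₁ {t}
  u≢u₁ ()

  u₁≢pathEnd : ∀ t → u₁ ≢ pathEnd v t
  u₁≢pathEnd zero    ()
  u₁≢pathEnd (suc t) ()

  u≢pathEnd : ∀ t → inj₁ u ≢ pathEnd {s = s} v t
  u≢pathEnd zero    refl = u≢v refl
  u≢pathEnd (suc t) ()

  Findex-G₂<G₁ : ∀ t →
    suc (deg (G₁′ t) (encode (pathEnd v t))) < deg (G₁′ t) (encode (inj₁ u)) →
    Findex (G₂ G u v s t) < Findex (G₁′ t)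
  Findex-G₂<G₁ t = MoveEdge.Findex-moveEdge-< (G₁′ t) (λ x y → adj-sym (decode x) (decode y))
    (decode-indicator (isU u) (inj₁ u) (⌊≟⌋-refl u) isU-only)
    (decode-indicator isU₁ u₁ refl isU₁-only)
    (decode-indicator (isVt v) (pathEnd v t) (isVt-end v t) (isVt-only t))
    (u≢u₁ ∘ encode-injective) (u₁≢pathEnd t ∘ encode-injective) (u≢pathEnd t ∘ encode-injective)
    (trans (G₁′-encode t _ _) (trans (cong (adj (inj₁ u)) (decode-encode u₁)) (adj-u-u₁ {t})))
    (trans (G₁′-encode t _ _) (trans (cong (adj (pathEnd v t)) (decode-encode u₁)) (adj-end-u₁ t)))

lemma4 : ∀ {n} (G : Adj n) → IsSimple G → (u v : Fin n) → u ≢ v →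
    deg G u ≥ deg G v → deg G v > 1 → (s t : ℕ) → s ≥ 1 →
    (t > 0 → Findex (G₁ G u v s t) > Findex (G₂ G u v s t))
    × (t ≡ 0 → deg G u > deg G v → Findex (G₁ G u v s t) > Findex (G₂ G u v s t))
lemma4 G _ u v _ _ _ zero t ()
lemma4 G (G-sym , _) u v u≢v du≥dv dv>1 (suc s′) t _ = path-at-v t , no-path-at-v t
  where
  open PathGraph G G-sym u≢v s′
  open ≤-Reasoning

  path-at-v : ∀ t → t > 0 → Findex (G₂ G u v s t) < Findex (G₁′ t)
  path-at-v (suc t) _ = Findex-G₂<G₁ (suc t) (begin-strict
    suc (deg (G₁′ (suc t)) _)  ≤⟨ s≤s (deg-end≤1 t) ⟩
    2                          <⟨ s≤s dv>1 ⟩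
    suc (deg G v)              ≤⟨ s≤s du≥dv ⟩
    suc (deg G u)              ≤⟨ deg-u-lower (suc t) ⟩
    deg (G₁′ (suc t)) _        ∎)

  no-path-at-v : ∀ t → t ≡ 0 → deg G u > deg G v → Findex (G₂ G u v s t) < Findex (G₁′ t)
  no-path-at-v .zero refl du>dv = Findex-G₂<G₁ 0 (begin-strict
    suc (deg (G₁′ 0) _)  ≡⟨ cong suc deg-v ⟩
    suc (deg G v)        <⟨ s≤s du>dv ⟩
    suc (deg G u)        ≤⟨ deg-u-lower 0 ⟩
    deg (G₁′ 0) _        ∎)
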